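{- The variety $\mathcal{CHA}$ of connexive Heyting algebras is $1$-ideal determined, i.e. it is both $1$-subtractive and $1$-regular.
   Context: A variety $\mathcal V$ whose language contains a constant $1$ is $1$-subtractive if for all congruences $\theta,\varphi$ of any $\mathbf A\in\mathcal V$, $1/(\theta\circ\varphi)=1/(\varphi\circ\theta)$ (the classes of $1$ under the relational composites coincide), and $1$-regular if for all congruences $\theta,\varphi$ of any $\mathbf A\in\mathcal V$, $1/\theta=1/\varphi$ implies $\theta=\varphi$. A connexive Heyting algebra is an algebra $\langle A,\wedge,\vee,\rightarrow,0,1\rangle$ whose $\{\wedge,\vee,0,1\}$-reduct is a bounded distributive lattice (order $\le$) satisfying, with $\neg x:=x\rightarrow0$: (C1) $(x\rightarrow y)\rightarrow((y\rightarrow z)\rightarrow(x\rightarrow z))=1$; (C2) $(x\rightarrow y)\rightarrow\neg(x\rightarrow\neg y)=1$; (C3) $x\wedge(x\rightarrow y)=x\wedge y$; (C4) $x\rightarrow y\le(z\wedge x)\rightarrow(z\wedge y)$; (C5) $x\rightarrow y\le(z\vee x)\rightarrow(z\vee y)$. -}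

module Defs where

open import Level using (Level; _⊔_; suc)
open import Data.Product using (Σ; _×_; _,_)
open import Relation.Binary.PropositionalEquality using (_≡_)
open import Relation.Binary.Structures using (IsEquivalence)

record ConnexiveHeytingAlgebra (a : Level) : Set (suc a) where
  infixr 7 _∧_
  infixr 6 _∨_
  infixr 5 _⇒_
  field
    Carrier : Set a
    _∧_ _∨_ _⇒_ : Carrier → Carrier → Carrier
    𝟘 𝟙 : Carrier
    ∧-comm   : ∀ x y → x ∧ y ≡ y ∧ x
    ∨-comm   : ∀ x y → x ∨ y ≡ y ∨ x
    ∧-assoc  : ∀ x y z → (x ∧ y) ∧ z ≡ x ∧ (y ∧ z)
    ∨-assoc  : ∀ x y z → (x ∨ y) ∨ z ≡ x ∨ (y ∨ z)
    ∧-absorbs-∨ : ∀ x y → x ∧ (x ∨ y) ≡ x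
    ∨-absorbs-∧ : ∀ x y → x ∨ (x ∧ y) ≡ x
    ∧-distribˡ-∨ : ∀ x y z → x ∧ (y ∨ z) ≡ (x ∧ y) ∨ (x ∧ z)
    𝟘-least  : ∀ x → 𝟘 ∧ x ≡ 𝟘
    𝟙-greatest : ∀ x → x ∧ 𝟙 ≡ x

  _≤_ : Carrier → Carrier → Set a
  x ≤ y = x ∧ y ≡ x

  ¬_ : Carrier → Carrier
  ¬ x = x ⇒ 𝟘

  field
    C1 : ∀ x y z → (x ⇒ y) ⇒ ((y ⇒ z) ⇒ (x ⇒ z)) ≡ 𝟙
    C2 : ∀ x y → (x ⇒ y) ⇒ (¬ (x ⇒ (¬ y))) ≡ 𝟙
    C3 : ∀ x y → x ∧ (x ⇒ y) ≡ x ∧ y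
    C4 : ∀ x y z → (x ⇒ y) ≤ ((z ∧ x) ⇒ (z ∧ y))
    C5 : ∀ x y z → (x ⇒ y) ≤ ((z ∨ x) ⇒ (z ∨ y))

module _ {a : Level} (A : ConnexiveHeytingAlgebra a) where
  open ConnexiveHeytingAlgebra A

  record IsCongruence {ℓ : Level} (θ : Carrier → Carrier → Set ℓ) : Set (a ⊔ ℓ) where
    field
      isEquivalence : IsEquivalence θ
      ∧-cong : ∀ {x x′ y y′} → θ x x′ → θ y y′ → θ (x ∧ y) (x′ ∧ y′)
      ∨-cong : ∀ {x x′ y y′} → θ x x′ → θ y y′ → θ (x ∨ y) (x′ ∨ y′)
      ⇒-cong : ∀ {x x′ y y′} → θ x x′ → θ y y′ → θ (x ⇒ y) (x′ ⇒ y′)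

_∘ᵣ_ : ∀ {a ℓ₁ ℓ₂} {X : Set a} → (X → X → Set ℓ₁) → (X → X → Set ℓ₂) → X → X → Set (a ⊔ ℓ₁ ⊔ ℓ₂)
(θ ∘ᵣ φ) x y = Σ _ λ z → θ x z × φ z y

1-Subtractive : ∀ {a} (ℓ : Level) → ConnexiveHeytingAlgebra a → Set (a ⊔ suc ℓ)
1-Subtractive ℓ A = ∀ (θ φ : Carrier → Carrier → Set ℓ) → IsCongruence A θ → IsCongruence A φ →
    ∀ x → ((θ ∘ᵣ φ) 𝟙 x → (φ ∘ᵣ θ) 𝟙 x) × ((φ ∘ᵣ θ) 𝟙 x → (θ ∘ᵣ φ) 𝟙 x)
  where open ConnexiveHeytingAlgebra A

1-Regular : ∀ {a} (ℓ : Level) → ConnexiveHeytingAlgebra a → Set (a ⊔ suc ℓ)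
1-Regular ℓ A = ∀ (θ φ : Carrier → Carrier → Set ℓ) → IsCongruence A θ → IsCongruence A φ →
    (∀ x → (θ 𝟙 x → φ 𝟙 x) × (φ 𝟙 x → θ 𝟙 x)) →
    ∀ x y → (θ x y → φ x y) × (φ x y → θ x y)
  where open ConnexiveHeytingAlgebra A

{-# OPTIONS --safe #-}
-- Only 𝟙 ⇒ y = y, x ⇒ x = 𝟙 and (C3) x ∧ (x ⇒ y) = x ∧ y are needed.  The first two make
-- z ⇒ x a subtraction term: from 𝟙 θ z φ x one gets 𝟙 = x ⇒ x φ z ⇒ x θ 𝟙 ⇒ x = x, which
-- is 1-subtractivity.  For 1-regularity, x θ y gives 𝟙 = y ⇒ y θ x ⇒ y, so 𝟙 lies in the
-- class of x ⇒ y; meeting with x and using (C3) shows x θ x ∧ y, so the 𝟙-class of θ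
-- alone decides whether x θ y.
module Submission where

open import Defs
open import Level using (Level)
open import Data.Product using (_×_; _,_; proj₁; proj₂)
open import Relation.Binary.Bundles using (Setoid)
open import Relation.Binary.PropositionalEquality using (_≡_; sym; cong₂; module ≡-Reasoning)
import Relation.Binary.Reasoning.Setoid as SetoidReasoning

module ConnexiveHeytingAlgebraProperties {a : Level} (A : ConnexiveHeytingAlgebra a) where
  open ConnexiveHeytingAlgebra A
  open ≡-Reasoning

  ∧-identityˡ : ∀ x → 𝟙 ∧ x ≡ x
  ∧-identityˡ x = begin
    𝟙 ∧ x   ≡⟨ ∧-comm 𝟙 x ⟩
    x ∧ 𝟙   ≡⟨ 𝟙-greatest x ⟩
    x       ∎

  ⇒-identityˡ : ∀ y → 𝟙 ⇒ y ≡ y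
  ⇒-identityˡ y = begin
    𝟙 ⇒ y         ≡⟨ ∧-identityˡ (𝟙 ⇒ y) ⟨
    𝟙 ∧ (𝟙 ⇒ y)   ≡⟨ C3 𝟙 y ⟩
    𝟙 ∧ y         ≡⟨ ∧-identityˡ y ⟩
    y             ∎

  x⇒x≡𝟙 : ∀ x → x ⇒ x ≡ 𝟙
  x⇒x≡𝟙 x = begin
    x ⇒ x                           ≡⟨ ∧-identityˡ (x ⇒ x) ⟨
    𝟙 ∧ (x ⇒ x)                     ≡⟨ cong₂ (λ u v → u ∧ (v ⇒ v)) (sym (⇒-identityˡ 𝟙)) (sym (𝟙-greatest x)) ⟩
    (𝟙 ⇒ 𝟙) ∧ ((x ∧ 𝟙) ⇒ (x ∧ 𝟙))   ≡⟨ C4 𝟙 𝟙 x ⟩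
    𝟙 ⇒ 𝟙                           ≡⟨ ⇒-identityˡ 𝟙 ⟩
    𝟙                               ∎

module CongruenceProperties {a ℓ : Level} {A : ConnexiveHeytingAlgebra a}
                            {θ : ConnexiveHeytingAlgebra.Carrier A → ConnexiveHeytingAlgebra.Carrier A → Set ℓ}
                            (θ-cong : IsCongruence A θ) where
  open ConnexiveHeytingAlgebra A
  open ConnexiveHeytingAlgebraProperties A
  open IsCongruence θ-cong

  setoid : Setoid a ℓ
  setoid = record { isEquivalence = isEquivalence }

  open Setoid setoid using (refl)
  open SetoidReasoning setoid

  𝟙-related-⇒ : ∀ {x y} → θ x y → θ 𝟙 (x ⇒ y)
  𝟙-related-⇒ {x} {y} xθy = begin
    𝟙       ≡⟨ x⇒x≡𝟙 y ⟨
    y ⇒ y   ≈⟨ ⇒-cong xθy refl ⟨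
    x ⇒ y   ∎

  ⇒-related-of-𝟙 : ∀ {z} x → θ 𝟙 z → θ (z ⇒ x) x
  ⇒-related-of-𝟙 {z} x 𝟙θz = begin
    z ⇒ x   ≈⟨ ⇒-cong 𝟙θz refl ⟨
    𝟙 ⇒ x   ≡⟨ ⇒-identityˡ x ⟩
    x       ∎

  ∧-related-of-𝟙-⇒ : ∀ {x y} → θ 𝟙 (x ⇒ y) → θ x (x ∧ y)
  ∧-related-of-𝟙-⇒ {x} {y} 𝟙θx⇒y = begin
    x             ≡⟨ 𝟙-greatest x ⟨
    x ∧ 𝟙         ≈⟨ ∧-cong refl 𝟙θx⇒y ⟩
    x ∧ (x ⇒ y)   ≡⟨ C3 x y ⟩
    x ∧ y         ∎

module CongruencePairProperties {a ℓ : Level} {A : ConnexiveHeytingAlgebra a}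
                                {θ φ : ConnexiveHeytingAlgebra.Carrier A → ConnexiveHeytingAlgebra.Carrier A → Set ℓ}
                                (θ-cong : IsCongruence A θ) (φ-cong : IsCongruence A φ) where
  open ConnexiveHeytingAlgebra A
  private
    module θ = CongruenceProperties θ-cong
    module φ = CongruenceProperties φ-cong

  open SetoidReasoning φ.setoid

  ∘ᵣ-swap-𝟙 : ∀ x → (θ ∘ᵣ φ) 𝟙 x → (φ ∘ᵣ θ) 𝟙 x
  ∘ᵣ-swap-𝟙 x (z , 𝟙θz , zφx) = z ⇒ x , φ.𝟙-related-⇒ zφx , θ.⇒-related-of-𝟙 x 𝟙θz

  𝟙-class-⊆⇒⊆ : (∀ x → θ 𝟙 x → φ 𝟙 x) → ∀ x y → θ x y → φ x y
  𝟙-class-⊆⇒⊆ 𝟙θ⊆𝟙φ x y xθy = begin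
    x       ≈⟨ φ.∧-related-of-𝟙-⇒ (𝟙θ⊆𝟙φ _ (θ.𝟙-related-⇒ xθy)) ⟩
    x ∧ y   ≡⟨ ∧-comm x y ⟩
    y ∧ x   ≈⟨ φ.∧-related-of-𝟙-⇒ (𝟙θ⊆𝟙φ _ (θ.𝟙-related-⇒ (Setoid.sym θ.setoid xθy))) ⟨
    y       ∎

lemma3p9 : ∀ {a ℓ : Level} (A : ConnexiveHeytingAlgebra a) → 1-Subtractive ℓ A × 1-Regular ℓ A
lemma3p9 A = subtractive , regular
  where
  open CongruencePairProperties
  subtractive : 1-Subtractive _ A
  subtractive θ φ θ-cong φ-cong x = ∘ᵣ-swap-𝟙 θ-cong φ-cong x , ∘ᵣ-swap-𝟙 φ-cong θ-cong x
  regular : 1-Regular _ A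
  regular θ φ θ-cong φ-cong same-𝟙-class x y =
      𝟙-class-⊆⇒⊆ θ-cong φ-cong (λ z → proj₁ (same-𝟙-class z)) x y
    , 𝟙-class-⊆⇒⊆ φ-cong θ-cong (λ z → proj₂ (same-𝟙-class z)) x y
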